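{- Let $n\ge 3$, $p\ge 1$ and $k\ge 1$ be integers. Then $$C_k(C_n\odot K_p)=\begin{cases}(k-1)n+1 & \text{if } k\le p+1,\\[2pt] pn+\left\lceil \frac{n}{2}\right\rceil & \text{if } k=p+2,\end{cases}$$ and $C_n\odot K_p$ is $k$-inconvertible if $k\ge p+3$.
   Context: Irreversible $k$-threshold process on a finite simple graph $G=(V,E)$: start with a set $S_0\subseteq V$ of colored vertices; for $t\ge1$, $S_t$ consists of $S_{t-1}$ together with every vertex having at least $k$ neighbors in $S_{t-1}$. $S_0$ is an irreversible $k$-threshold conversion set if $S_t=V$ for some $t\ge 0$. $C_k(G)$ is the minimum size of such a set. $G$ is $k$-inconvertible if $C_k(G)=|V|$. Corona product $C_n\odot K_p$: take a cycle $C_n$ with vertices $v_1,\dots,v_n$ and $n$ disjoint copies of $K_p$, the $i$-th copy having vertices $u_i^1,\dots,u_i^p$; join $v_i$ to every $u_i^j$, $1\le j\le p$. -}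

module Defs where

open import Data.Bool using (Bool; true; false; _∧_; _∨_; not; T; if_then_else_)
open import Data.Bool.Properties using (∨-comm; ∧-comm)
open import Data.Nat using (ℕ; zero; suc; _≤_; _≤ᵇ_; _∸_; _*_; _+_)
open import Data.Nat.Base using (_≡ᵇ_)
open import Data.Fin using (Fin; toℕ; remQuot)
open import Data.Fin.Subset using (Subset; ∣_∣; _∩_; ⊤)
open import Data.Vec using (tabulate; lookup)
open import Data.Product using (∃; _×_; _,_; proj₁; proj₂)
open import Relation.Binary.PropositionalEquality using (_≡_; refl; cong; cong₂)

record Graph : Set where
  field
    N     : ℕ
    Adj   : Fin N → Fin N → Bool
    sym   : ∀ u v → Adj u v ≡ Adj v u
    irrefl : ∀ v → Adj v v ≡ false

open Graph public

nbhd : (G : Graph) → Fin (N G) → Subset (N G)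
nbhd G v = tabulate (Adj G v)

step : (G : Graph) → ℕ → Subset (N G) → Subset (N G)
step G k S = tabulate λ v → lookup S v ∨ (k ≤ᵇ ∣ nbhd G v ∩ S ∣)

iter : (G : Graph) → ℕ → Subset (N G) → ℕ → Subset (N G)
iter G k S zero    = S
iter G k S (suc t) = step G k (iter G k S t)

IsConversionSet : (G : Graph) → ℕ → Subset (N G) → Set
IsConversionSet G k S = ∃ λ t → iter G k S t ≡ ⊤

ConvNumber : (G : Graph) → ℕ → ℕ → Set
ConvNumber G k m =
  (∃ λ S → IsConversionSet G k S × ∣ S ∣ ≡ m)
  × (∀ S → IsConversionSet G k S → m ≤ ∣ S ∣)

Inconvertible : Graph → ℕ → Set
Inconvertible G k = ConvNumber G k (N G)

-- Vertex set Fin (n * suc p); vertex x is decoded by remQuot as (i , j)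
-- with i : Fin n, j : Fin (suc p): j = 0 is the cycle vertex v_i and
-- j = suc a is the clique vertex u_i^(a+1).

cycArc : (n : ℕ) → ℕ → ℕ → Bool
cycArc n a b = not (a ≡ᵇ b) ∧ ((b ≡ᵇ suc a) ∨ ((a ≡ᵇ 0) ∧ (b ≡ᵇ (n ∸ 1))))

cycAdj : (n : ℕ) → ℕ → ℕ → Bool
cycAdj n a b = cycArc n a b ∨ cycArc n b a

-- (i , j) ~ (i' , j') iff
--   i = i' and j ≠ j'   (v_i–u_i^a edges and edges inside the i-th K_p), or
--   j = j' = 0 and v_i v_i' is an edge of C_n.
coronaAdjPair : (n : ℕ) → ℕ → ℕ → ℕ → ℕ → Bool
coronaAdjPair n i j i' j' =
  ((i ≡ᵇ i') ∧ not (j ≡ᵇ j')) ∨ ((j ≡ᵇ 0) ∧ (j' ≡ᵇ 0) ∧ cycAdj n i i')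

coronaAdj : (n p : ℕ) → Fin (n * suc p) → Fin (n * suc p) → Bool
coronaAdj n p x y =
  coronaAdjPair n (cyc x) (lvl x) (cyc y) (lvl y)
  where
  cyc lvl : Fin (n * suc p) → ℕ
  cyc z = toℕ (proj₁ (remQuot {n} (suc p) z))
  lvl z = toℕ (proj₂ (remQuot {n} (suc p) z))

private
  ≡ᵇ-refl : ∀ a → (a ≡ᵇ a) ≡ true
  ≡ᵇ-refl zero = refl
  ≡ᵇ-refl (suc a) = ≡ᵇ-refl a

  ≡ᵇ-sym : ∀ a b → (a ≡ᵇ b) ≡ (b ≡ᵇ a)
  ≡ᵇ-sym zero zero = refl
  ≡ᵇ-sym zero (suc b) = refl
  ≡ᵇ-sym (suc a) zero = refl
  ≡ᵇ-sym (suc a) (suc b) = ≡ᵇ-sym a b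

  cycAdj-sym : ∀ n a b → cycAdj n a b ≡ cycAdj n b a
  cycAdj-sym n a b = ∨-comm (cycArc n a b) (cycArc n b a)

  ∧-sym3 : ∀ x y z w → z ≡ w → x ∧ y ∧ z ≡ y ∧ x ∧ w
  ∧-sym3 true  true  z .z refl = refl
  ∧-sym3 true  false z .z refl = refl
  ∧-sym3 false true  z .z refl = refl
  ∧-sym3 false false z .z refl = refl

  pair-sym : ∀ n i j i' j' → coronaAdjPair n i j i' j' ≡ coronaAdjPair n i' j' i j
  pair-sym n i j i' j' =
    cong₂ _∨_ (cong₂ _∧_ (≡ᵇ-sym i i') (cong not (≡ᵇ-sym j j')))
              (∧-sym3 (j ≡ᵇ 0) (j' ≡ᵇ 0) _ _ (cycAdj-sym n i i'))

  pair-irrefl : ∀ n i j → coronaAdjPair n i j i j ≡ false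
  pair-irrefl n i j rewrite ≡ᵇ-refl i | ≡ᵇ-refl j with (j ≡ᵇ 0)
  ... | true  = refl
  ... | false = refl

corona-sym : ∀ n p x y → coronaAdj n p x y ≡ coronaAdj n p y x
corona-sym n p x y =
  pair-sym n (toℕ (proj₁ (remQuot {n} (suc p) x))) (toℕ (proj₂ (remQuot {n} (suc p) x)))
             (toℕ (proj₁ (remQuot {n} (suc p) y))) (toℕ (proj₂ (remQuot {n} (suc p) y)))

corona-irrefl : ∀ n p x → coronaAdj n p x x ≡ false
corona-irrefl n p x =
  pair-irrefl n (toℕ (proj₁ (remQuot {n} (suc p) x))) (toℕ (proj₂ (remQuot {n} (suc p) x)))

CnCoronaKp : ℕ → ℕ → Graph
CnCoronaKp n p = record
  { N = n * suc p ; Adj = coronaAdj n p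
  ; sym = corona-sym n p ; irrefl = corona-irrefl n p }

-- The process only adds vertices, so if every vertex of a set U outside S has fewer than k
-- neighbours outside U, no vertex of U is ever coloured; all lower bounds come from such sets.
-- In C_n ⊙ K_p the cycle vertex v_c is adjacent to the p vertices of its clique and to v_{c±1},
-- and a clique vertex to the other p vertices of its row, so the degrees are p + 2 and p.
-- For k ≥ p + 3 no vertex is ever added.  For k = p + 2 every clique vertex lies in S, and two
-- consecutive cycle vertices outside S block each other, so S contains a vertex cover of C_n
-- (at least ⌈n/2⌉ vertices; the even positions suffice).  For k ≤ p + 1 a clique with fewer
-- than k - 1 vertices in S keeps its uncoloured vertices, and if no row had k vertices in S
-- no vertex outside S could ever be coloured; conversely v_0 with k - 1 vertices of every clique
-- colours the cycle one vertex per step, and each coloured v_c then completes its clique.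
module Submission where

open import Data.Bool using (Bool; true; false; _∧_; _∨_; not; T; if_then_else_)
open import Data.Bool.Properties
  using (T-≡; T-∧; T-∨; ∨-comm; ∨-zeroʳ; ∨-identityʳ; not-involutive; not-injective)
open import Data.Empty using (⊥-elim)
open import Data.Fin
  using (Fin; zero; suc; toℕ; combine; remQuot; inject₁; fromℕ; lower₁; punchIn; _↑ˡ_; _↑ʳ_)
open import Data.Fin.Properties
  using ( toℕ-injective; toℕ<n; toℕ-fromℕ; toℕ-inject₁; toℕ-inject₁-≢; toℕ-lower₁; inject₁-lower₁
        ; remQuot-combine; combine-remQuot; any?; ¬∀⟶∃¬ )
open import Data.Fin.Subset using (Subset; _∈_; _∉_; _⊆_; _∩_; ∣_∣; ⊤)
open import Data.Fin.Subset.Properties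
  using ( _∈?_; ∈⊤; ⊆⊤; ⊆-antisym; x∈p∩q⁺; x∈p∩q⁻; ∩-identityʳ; p⊆q⇒∣p∣≤∣q∣; ∣p∩q∣≤∣p∣; ∣⊤∣≡n )
open import Data.Nat
open import Data.Nat.Properties
open import Algebra.Properties.CommutativeMonoid.Sum +-0-commutativeMonoid
  using (sum; sum-cong-≗; sum-replicate-zero; sum-init-last; sum-remove; ∑-distrib-+)
open import Data.Product using (_×_; _,_; proj₁; proj₂; ∃; uncurry)
open import Data.Sum using (_⊎_; inj₁; inj₂; [_,_]′) renaming (map to ⊎-map)
open import Data.Vec using (lookup; tabulate; []; _∷_)
open import Data.Vec.Properties using (lookup∘tabulate; lookup-zipWith; []=⇒lookup; lookup⇒[]=)
open import Function using (_∘_; _∘₂_; Equivalence)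
open import Relation.Binary.PropositionalEquality
  using (_≡_; _≢_; refl; sym; trans; cong; cong₂; subst; ≢-sym; module ≡-Reasoning)
open import Relation.Nullary using (¬_; Dec; yes; no)
open import Relation.Nullary.Decidable using (dec-true; dec-false; decidable-stable)

open import Defs hiding (sym)

𝟙 : Bool → ℕ
𝟙 b = if b then 1 else 0

𝟙≤1 : ∀ b → 𝟙 b ≤ 1
𝟙≤1 true  = ≤-refl
𝟙≤1 false = z≤n

≡ᵇ-refl : ∀ a → (a ≡ᵇ a) ≡ true
≡ᵇ-refl a = dec-true (a ≟ a) refl

≢⇒≡ᵇ-false : ∀ {a b} → a ≢ b → (a ≡ᵇ b) ≡ false
≢⇒≡ᵇ-false {a} {b} = dec-false (a ≟ b)

toℕ-≡ᵇ⇒≡ : ∀ {m} {x y : Fin m} → T (toℕ x ≡ᵇ toℕ y) → x ≡ y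
toℕ-≡ᵇ⇒≡ = toℕ-injective ∘ ≡ᵇ⇒≡ _ _

≡⇒toℕ-≡ᵇ : ∀ {m} {x y : Fin m} → x ≡ y → T (toℕ x ≡ᵇ toℕ y)
≡⇒toℕ-≡ᵇ = ≡⇒≡ᵇ _ _ ∘ cong toℕ

𝟙-∧-split : ∀ e a b w → (T e → T a ⊎ T b) → (T a → T e) → (T b → T e) → (T a → ¬ T b) →
            𝟙 (e ∧ w) ≡ (if a then 𝟙 w else 0) + (if b then 𝟙 w else 0)
𝟙-∧-split true  true  true  w _  _   _   a∧b = ⊥-elim (a∧b _ _)
𝟙-∧-split true  true  false w _  _   _   _   = sym (+-identityʳ (𝟙 w))
𝟙-∧-split true  false true  w _  _   _   _   = refl
𝟙-∧-split true  false false w e⇒ _   _   _   with e⇒ _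
... | inj₁ ()
... | inj₂ ()
𝟙-∧-split false true  _     w _  a⇒e _   _   = ⊥-elim (a⇒e _)
𝟙-∧-split false false true  w _  _   b⇒e _   = ⊥-elim (b⇒e _)
𝟙-∧-split false false false w _  _   _   _   = refl

even : ℕ → Bool
even zero    = true
even (suc k) = not (even k)

-- Finite sums

sum-mono-≤ : ∀ {m} {f g : Fin m → ℕ} → (∀ i → f i ≤ g i) → sum f ≤ sum g
sum-mono-≤ {zero}  f≤g = z≤n
sum-mono-≤ {suc m} f≤g = +-mono-≤ (f≤g zero) (sum-mono-≤ (f≤g ∘ suc))

sum-const : ∀ m c → sum {m} (λ _ → c) ≡ m * c
sum-const zero    c = refl
sum-const (suc m) c = cong (c +_) (sum-const m c)

m*a+1≤sum : ∀ {m} {f : Fin m → ℕ} a c → (∀ i → a ≤ f i) → suc a ≤ f c → m * a + 1 ≤ sum f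
m*a+1≤sum {suc m} {f} a c a≤f a<fc = begin
  suc m * a + 1              ≡⟨ +-comm (suc m * a) 1 ⟩
  suc a + m * a              ≡⟨ cong (suc a +_) (sum-const m a) ⟨
  suc a + sum {m} (λ _ → a)  ≤⟨ +-mono-≤ a<fc (sum-mono-≤ (a≤f ∘ punchIn c)) ⟩
  f c + sum (f ∘ punchIn c)  ≡⟨ sum-remove f ⟨
  sum f                      ∎
  where open ≤-Reasoning

sum-↑ : ∀ m k (f : Fin (m + k) → ℕ) → sum f ≡ sum (λ i → f (i ↑ˡ k)) + sum (λ j → f (m ↑ʳ j))
sum-↑ zero    k f = refl
sum-↑ (suc m) k f = trans (cong (f zero +_) (sum-↑ m k (f ∘ suc))) (sym (+-assoc (f zero) _ _))

sum-combine : ∀ m q (f : Fin (m * q) → ℕ) → sum f ≡ sum {m} (λ i → sum {q} (λ j → f (combine i j)))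
sum-combine zero    q f = refl
sum-combine (suc m) q f = trans (sum-↑ q (m * q) f)
  (cong (sum {q} (λ j → f (j ↑ˡ (m * q))) +_) (sum-combine m q (λ x → f (q ↑ʳ x))))

sum-δ : ∀ {m} (c : Fin m) (f : Fin m → ℕ) → sum (λ i → if toℕ c ≡ᵇ toℕ i then f i else 0) ≡ f c
sum-δ {suc m} zero    f = trans (cong (f zero +_) (sum-replicate-zero m)) (+-identityʳ (f zero))
sum-δ {suc m} (suc c) f = sum-δ c (f ∘ suc)

sum-except : ∀ {m} (a : Fin m) (w : Fin m → Bool) →
             sum (λ b → 𝟙 (not (toℕ a ≡ᵇ toℕ b) ∧ w b)) + 𝟙 (w a) ≡ sum (𝟙 ∘ w)
sum-except {m} a w = begin
  sum others + 𝟙 (w a)           ≡⟨ cong (sum others +_) (sum-δ a (𝟙 ∘ w)) ⟨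
  sum others + sum at-a          ≡⟨ ∑-distrib-+ others at-a ⟨
  sum (λ b → others b + at-a b)  ≡⟨ sum-cong-≗ (λ b → split (toℕ a ≡ᵇ toℕ b) (w b)) ⟩
  sum (𝟙 ∘ w)                    ∎
  where
  open ≡-Reasoning
  others at-a : Fin m → ℕ
  others b = 𝟙 (not (toℕ a ≡ᵇ toℕ b) ∧ w b)
  at-a   b = if toℕ a ≡ᵇ toℕ b then 𝟙 (w b) else 0
  split : ∀ t x → 𝟙 (not t ∧ x) + (if t then 𝟙 x else 0) ≡ 𝟙 x
  split true  x = refl
  split false x = +-identityʳ (𝟙 x)

sum-<ᵇ : ∀ {m} k → k ≤ m → sum {m} (λ a → 𝟙 (toℕ a <ᵇ k)) ≡ k
sum-<ᵇ {m}     zero    _         = sum-replicate-zero m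
sum-<ᵇ {suc m} (suc k) (s≤s k≤m) = cong suc (sum-<ᵇ k k≤m)

sum-even : ∀ m → sum {m} (λ i → 𝟙 (even (toℕ i))) ≡ ⌈ m /2⌉
sum-odd  : ∀ m → sum {m} (λ i → 𝟙 (not (even (toℕ i)))) ≡ ⌊ m /2⌋
sum-even zero    = refl
sum-even (suc m) = cong suc (sum-odd m)
sum-odd  zero    = refl
sum-odd  (suc m) = trans (sum-cong-≗ {m} (λ i → cong 𝟙 (not-involutive (even (toℕ i))))) (sum-even m)

size-sum : ∀ {m} (S : Subset m) → ∣ S ∣ ≡ sum (𝟙 ∘ lookup S)
size-sum []          = refl
size-sum (true  ∷ S) = cong suc (size-sum S)
size-sum (false ∷ S) = size-sum S

𝟙-∈ : ∀ {m x} {S : Subset m} → x ∈ S → 𝟙 (lookup S x) ≡ 1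
𝟙-∈ x∈S = cong 𝟙 ([]=⇒lookup x∈S)

𝟙-⊤ : ∀ {m} (x : Fin m) → 𝟙 (lookup ⊤ x) ≡ 1
𝟙-⊤ {m} x = 𝟙-∈ {m} {S = ⊤} ∈⊤

𝟙-∉ : ∀ {m x} {S : Subset m} → x ∉ S → 𝟙 (lookup S x) ≡ 0
𝟙-∉ {x = x} {S} x∉S with lookup S x in eq
... | true  = ⊥-elim (x∉S (lookup⇒[]= x S eq))
... | false = refl

𝟙-mono : ∀ {m x} {S S′ : Subset m} → (x ∈ S → x ∈ S′) → 𝟙 (lookup S x) ≤ 𝟙 (lookup S′ x)
𝟙-mono {x = x} {S} {S′} S⇒S′ with lookup S x in eq
... | false = z≤n
... | true  = ≤-reflexive (sym (𝟙-∈ (S⇒S′ (lookup⇒[]= x S eq))))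

-- The threshold process

degree : (G : Graph) → Fin (N G) → ℕ
degree G x = ∣ nbhd G x ∣

degreeIn : (G : Graph) → Fin (N G) → Subset (N G) → ℕ
degreeIn G x W = ∣ nbhd G x ∩ W ∣

degreeIn-sum : ∀ G x W → degreeIn G x W ≡ sum (λ y → 𝟙 (Adj G x y ∧ lookup W y))
degreeIn-sum G x W = trans (size-sum (nbhd G x ∩ W)) (sum-cong-≗ λ y → cong 𝟙
  (trans (lookup-zipWith _∧_ y (nbhd G x) W) (cong (_∧ lookup W y) (lookup∘tabulate (Adj G x) y))))

degreeIn-⊤ : ∀ G x → degreeIn G x ⊤ ≡ degree G x
degreeIn-⊤ G x = cong ∣_∣ (∩-identityʳ (nbhd G x))

module Threshold (G : Graph) (k : ℕ) where

  private
    V : Set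
    V = Fin (N G)

  degreeIn-mono : ∀ {x W W′} → W ⊆ W′ → degreeIn G x W ≤ degreeIn G x W′
  degreeIn-mono {x} W⊆W′ = p⊆q⇒∣p∣≤∣q∣ λ y∈ →
    let y∈N , y∈W = x∈p∩q⁻ (nbhd G x) _ y∈ in x∈p∩q⁺ (y∈N , W⊆W′ y∈W)

  degreeIn≤degree : ∀ x W → degreeIn G x W ≤ degree G x
  degreeIn≤degree x = ∣p∩q∣≤∣p∣ (nbhd G x)

  lookup-step : ∀ S x → lookup (step G k S) x ≡ (lookup S x ∨ (k ≤ᵇ degreeIn G x S))
  lookup-step S = lookup∘tabulate _

  ∈-step⁺ : ∀ {S x} → k ≤ degreeIn G x S → x ∈ step G k S
  ∈-step⁺ {S} {x} k≤d = lookup⇒[]= x _ (begin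
    lookup (step G k S) x               ≡⟨ lookup-step S x ⟩
    lookup S x ∨ (k ≤ᵇ degreeIn G x S)  ≡⟨ cong (lookup S x ∨_) (Equivalence.to T-≡ (≤⇒≤ᵇ k≤d)) ⟩
    lookup S x ∨ true                   ≡⟨ ∨-zeroʳ (lookup S x) ⟩
    true                                ∎)
    where open ≡-Reasoning

  ∈-step⁻ : ∀ {S x} → x ∈ step G k S → x ∈ S ⊎ k ≤ degreeIn G x S
  ∈-step⁻ {S} {x} x∈ with lookup S x in x∈S | k ≤ᵇ degreeIn G x S in k≤d
                        | trans (sym ([]=⇒lookup x∈)) (lookup-step S x)
  ... | true  | _     | _  = inj₁ (lookup⇒[]= x S x∈S)
  ... | false | true  | _  = inj₂ (≤ᵇ⇒≤ k _ (subst T (sym k≤d) _))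
  ... | false | false | ()

  ⊆-step : ∀ {S} → S ⊆ step G k S
  ⊆-step {S} {x} x∈S =
    lookup⇒[]= x _ (trans (lookup-step S x) (cong (_∨ (k ≤ᵇ degreeIn G x S)) ([]=⇒lookup x∈S)))

  iter-mono : ∀ S {t t′} → t ≤ t′ → iter G k S t ⊆ iter G k S t′
  iter-mono S t≤t′ = go (≤⇒≤′ t≤t′)
    where
    go : ∀ {t t′} → t ≤′ t′ → iter G k S t ⊆ iter G k S t′
    go ≤′-refl        = λ x∈ → x∈
    go (≤′-step t≤t′) = ⊆-step ∘ go t≤t′

  conversion-at : ∀ {S} t → (∀ x → x ∈ iter G k S t) → IsConversionSet G k S
  conversion-at t all = t , ⊆-antisym ⊆⊤ (λ {x} _ → all x)

  Blocking : (V → Set) → Set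
  Blocking U = ∀ {x} → U x → ∀ W → (∀ {y} → U y → y ∉ W) → degreeIn G x W < k

  blocking-unreached : ∀ {U S} → Blocking U → (∀ {x} → U x → x ∉ S) →
                       ∀ t {x} → U x → x ∉ iter G k S t
  blocking-unreached blk U∉S zero    = U∉S
  blocking-unreached blk U∉S (suc t) Ux x∈ with ∈-step⁻ x∈
  ... | inj₁ x∈Sₜ = blocking-unreached blk U∉S t Ux x∈Sₜ
  ... | inj₂ k≤d  = <⇒≱ (blk Ux _ (blocking-unreached blk U∉S t)) k≤d

  blocking-¬conversion : ∀ {U S x} → Blocking U → (∀ {y} → U y → y ∉ S) → U x →
                         ¬ IsConversionSet G k S
  blocking-¬conversion {x = x} blk U∉S Ux (t , Sₜ≡⊤) =
    blocking-unreached blk U∉S t Ux (subst (x ∈_) (sym Sₜ≡⊤) ∈⊤)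

  lowDegree-∈ : ∀ {S x} → degree G x < k → IsConversionSet G k S → x ∈ S
  lowDegree-∈ {S} {x} d<k conv with x ∈? S
  ... | yes x∈S = x∈S
  ... | no  x∉S = ⊥-elim (blocking-¬conversion blk (λ { refl → x∉S }) refl conv)
    where
    blk : Blocking (_≡ x)
    blk refl W _ = ≤-<-trans (degreeIn≤degree x W) d<k

  inconvertible : (∀ x → degree G x < k) → Inconvertible G k
  inconvertible d<k =
    (⊤ , (0 , refl) , ∣⊤∣≡n _) ,
    λ S conv → subst (_≤ ∣ S ∣) (∣⊤∣≡n _) (p⊆q⇒∣p∣≤∣q∣ {p = ⊤} (λ {x} _ → lowDegree-∈ (d<k x) conv))

-- The cycle

prev : ∀ {l} → Fin (suc l) → Fin (suc l)
prev zero    = fromℕ _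
prev (suc i) = inject₁ i

next : ∀ {l} → Fin (suc l) → Fin (suc l)
next {l} i with l ≟ toℕ i
... | yes _   = zero
... | no  l≢i = suc (lower₁ i l≢i)

next-prev : ∀ {l} (i : Fin (suc l)) → next (prev i) ≡ i
next-prev {l} zero with l ≟ toℕ (fromℕ l)
... | yes _   = refl
... | no  l≢l = ⊥-elim (l≢l (sym (toℕ-fromℕ l)))
next-prev {l} (suc i) with l ≟ toℕ (inject₁ i)
... | yes l≡i = ⊥-elim (toℕ-inject₁-≢ i l≡i)
... | no  l≢i = cong suc (toℕ-injective (trans (toℕ-lower₁ _ l≢i) (toℕ-inject₁ i)))

prev-next : ∀ {l} (i : Fin (suc l)) → prev (next i) ≡ i
prev-next {l} i with l ≟ toℕ i
... | yes l≡i = toℕ-injective (trans (toℕ-fromℕ l) l≡i)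
... | no  l≢i = inject₁-lower₁ i l≢i

prev≡⇒≡next : ∀ {l} {c i : Fin (suc l)} → prev i ≡ c → i ≡ next c
prev≡⇒≡next {i = i} eq = trans (sym (next-prev i)) (cong next eq)

toℕ-next : ∀ {l} (i : Fin (suc l)) → next i ≡ zero ⊎ toℕ (next i) ≡ suc (toℕ i)
toℕ-next {l} i with l ≟ toℕ i
... | yes _   = inj₁ refl
... | no  l≢i = inj₂ (cong suc (toℕ-lower₁ i l≢i))

prev-suc : ∀ {l} {x : Fin (suc l)} y → toℕ y ≡ suc (toℕ x) → prev y ≡ x
prev-suc (suc y) y≡1+x = toℕ-injective (trans (toℕ-inject₁ y) (suc-injective y≡1+x))

prev-zero : ∀ {l} {x y : Fin (suc l)} → toℕ x ≡ 0 → toℕ y ≡ l → prev x ≡ y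
prev-zero {x = zero} _ y≡l = toℕ-injective (trans (toℕ-fromℕ _) (sym y≡l))

prev²≢id : ∀ {m} (c : Fin (3 + m)) → prev (prev c) ≢ c
prev²≢id zero          ()
prev²≢id (suc zero)    ()
prev²≢id (suc (suc c)) eq =
  m≢1+n+m (toℕ c) (trans (sym (trans (toℕ-inject₁ (inject₁ c)) (toℕ-inject₁ c))) (cong toℕ eq))

next≢prev : ∀ {m} (c : Fin (3 + m)) → next c ≢ prev c
next≢prev c eq = prev²≢id c (trans (cong prev (sym eq)) (prev-next c))

sum-prev : ∀ {l} (f : Fin (suc l) → ℕ) → sum (f ∘ prev) ≡ sum f
sum-prev f = trans (+-comm (f (fromℕ _)) _) (sym (sum-init-last f))

even-next : ∀ {l} (i : Fin (suc l)) → even (toℕ i) ≡ false → even (toℕ (next i)) ≡ true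
even-next i odd with toℕ-next i
... | inj₁ next≡0  rewrite next≡0  = refl
... | inj₂ next≡1+ rewrite next≡1+ | odd = refl

even-prev : ∀ {l} (i : Fin (suc l)) → even (toℕ i) ≡ false → even (toℕ (prev i)) ≡ true
even-prev (suc i) odd rewrite toℕ-inject₁ i = not-injective odd

cycArc-suc : ∀ n a → T (cycArc n a (suc a))
cycArc-suc n a rewrite ≢⇒≡ᵇ-false (≢-sym (1+n≢n {a})) | ≡ᵇ-refl a = _

cycArc⇒prev : ∀ {l} (x y : Fin (suc l)) → T (cycArc (suc l) (toℕ x) (toℕ y)) → prev y ≡ x ⊎ prev x ≡ y
cycArc⇒prev x y arc
  with Equivalence.to (T-∨ {toℕ y ≡ᵇ suc (toℕ x)}) (proj₂ (Equivalence.to (T-∧ {not (toℕ x ≡ᵇ toℕ y)}) arc))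
... | inj₁ y≡1+x = inj₁ (prev-suc y (≡ᵇ⇒≡ _ _ y≡1+x))
... | inj₂ wrap  = let x≡0 , y≡l = Equivalence.to (T-∧ {toℕ x ≡ᵇ 0}) wrap in
                   inj₂ (prev-zero {x = x} (≡ᵇ⇒≡ _ 0 x≡0) (≡ᵇ⇒≡ (toℕ y) _ y≡l))

cycAdj⇒next⊎prev : ∀ {l} (c i : Fin (suc l)) → T (cycAdj (suc l) (toℕ c) (toℕ i)) → i ≡ next c ⊎ i ≡ prev c
cycAdj⇒next⊎prev {l} c i adj with Equivalence.to (T-∨ {cycArc (suc l) (toℕ c) (toℕ i)}) adj
... | inj₁ arc = [ inj₁ ∘ prev≡⇒≡next , inj₂ ∘ sym ]′ (cycArc⇒prev c i arc)
... | inj₂ arc = [ inj₂ ∘ sym , inj₁ ∘ prev≡⇒≡next ]′ (cycArc⇒prev i c arc)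

cycAdj-prev : ∀ {l} (c : Fin (2 + l)) → T (cycAdj (2 + l) (toℕ c) (toℕ (prev c)))
cycAdj-prev {l} zero rewrite toℕ-fromℕ l | ≡ᵇ-refl l | ∨-zeroʳ (l ≡ᵇ 0) = _
cycAdj-prev {l} (suc c) rewrite toℕ-inject₁ c =
  Equivalence.from (T-∨ {cycArc (2 + l) (suc (toℕ c)) (toℕ c)}) (inj₂ (cycArc-suc (2 + l) (toℕ c)))

cycAdj-next : ∀ {l} (c : Fin (2 + l)) → T (cycAdj (2 + l) (toℕ c) (toℕ (next c)))
cycAdj-next {l} c = subst T (∨-comm (cycArc (2 + l) (toℕ (next c)) (toℕ c)) _)
  (subst (λ i → T (cycAdj (2 + l) (toℕ (next c)) (toℕ i))) (prev-next c) (cycAdj-prev (next c)))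

sum-cycAdj : ∀ {m} (c : Fin (3 + m)) (w : Fin (3 + m) → Bool) →
             sum (λ i → 𝟙 (cycAdj (3 + m) (toℕ c) (toℕ i) ∧ w i)) ≡ 𝟙 (w (next c)) + 𝟙 (w (prev c))
sum-cycAdj {m} c w = begin
  sum (λ i → 𝟙 (cycAdj (3 + m) (toℕ c) (toℕ i) ∧ w i))
    ≡⟨ sum-cong-≗ (λ i → 𝟙-∧-split _ _ _ (w i) (adj⇒ i) (adj-next i) (adj-prev i) (next≢prev c ∘₂ both)) ⟩
  sum (λ i → at (next c) i + at (prev c) i)
    ≡⟨ ∑-distrib-+ (at (next c)) (at (prev c)) ⟩
  sum (at (next c)) + sum (at (prev c))
    ≡⟨ cong₂ _+_ (sum-δ (next c) (𝟙 ∘ w)) (sum-δ (prev c) (𝟙 ∘ w)) ⟩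
  𝟙 (w (next c)) + 𝟙 (w (prev c)) ∎
  where
  open ≡-Reasoning
  at : Fin (3 + m) → Fin (3 + m) → ℕ
  at x i = if toℕ x ≡ᵇ toℕ i then 𝟙 (w i) else 0
  adj⇒ : ∀ i → T (cycAdj (3 + m) (toℕ c) (toℕ i)) → T (toℕ (next c) ≡ᵇ toℕ i) ⊎ T (toℕ (prev c) ≡ᵇ toℕ i)
  adj⇒ i = ⊎-map (≡⇒toℕ-≡ᵇ ∘ sym) (≡⇒toℕ-≡ᵇ ∘ sym) ∘ cycAdj⇒next⊎prev c i
  adj-next : ∀ i → T (toℕ (next c) ≡ᵇ toℕ i) → T (cycAdj (3 + m) (toℕ c) (toℕ i))
  adj-next i eq = subst (λ j → T (cycAdj (3 + m) (toℕ c) (toℕ j))) (toℕ-≡ᵇ⇒≡ eq) (cycAdj-next c)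
  adj-prev : ∀ i → T (toℕ (prev c) ≡ᵇ toℕ i) → T (cycAdj (3 + m) (toℕ c) (toℕ i))
  adj-prev i eq = subst (λ j → T (cycAdj (3 + m) (toℕ c) (toℕ j))) (toℕ-≡ᵇ⇒≡ eq) (cycAdj-prev c)
  both : ∀ {i} → T (toℕ (next c) ≡ᵇ toℕ i) → T (toℕ (prev c) ≡ᵇ toℕ i) → next c ≡ prev c
  both a b = trans (toℕ-≡ᵇ⇒≡ a) (sym (toℕ-≡ᵇ⇒≡ b))

-- The corona C_n ⊙ K_p, with n = 3 + m

module Corona (m p : ℕ) where

  n : ℕ
  n = 3 + m

  G : Graph
  G = CnCoronaKp n p

  V : Set
  V = Fin (N G)

  v : Fin n → V
  v c = combine c zero

  u : Fin n → Fin p → V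
  u c a = combine c (suc a)

  vertex-cases : ∀ {P : V → Set} → (∀ c → P (v c)) → (∀ c a → P (u c a)) → ∀ x → P x
  vertex-cases {P} Pv Pu x = subst P (combine-remQuot {n} (suc p) x) (by-level (remQuot {n} (suc p) x))
    where
    by-level : ∀ cj → P (uncurry combine cj)
    by-level (c , zero)  = Pv c
    by-level (c , suc a) = Pu c a

  Adj-combine : ∀ (i : Fin n) (j : Fin (suc p)) (i′ : Fin n) (j′ : Fin (suc p)) →
                Adj G (combine i j) (combine i′ j′) ≡ coronaAdjPair n (toℕ i) (toℕ j) (toℕ i′) (toℕ j′)
  Adj-combine i j i′ j′ =
    cong₂ (λ x y → coronaAdjPair n (toℕ (proj₁ x)) (toℕ (proj₂ x)) (toℕ (proj₁ y)) (toℕ (proj₂ y)))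
          (remQuot-combine {n} {suc p} i j) (remQuot-combine {n} {suc p} i′ j′)

  fromRows : (Fin n → Fin (suc p) → Bool) → Subset (N G)
  fromRows F = tabulate (uncurry F ∘ remQuot {n} (suc p))

  lookup-fromRows : ∀ F i j → lookup (fromRows F) (combine i j) ≡ F i j
  lookup-fromRows F i j =
    trans (lookup∘tabulate (uncurry F ∘ remQuot {n} (suc p)) (combine i j))
          (cong (uncurry F) (remQuot-combine {n} i j))

  ∈-fromRows : ∀ F i j → F i j ≡ true → combine i j ∈ fromRows F
  ∈-fromRows F i j Fij = lookup⇒[]= (combine i j) (fromRows F) (trans (lookup-fromRows F i j) Fij)

  onCycle : Subset (N G) → Fin n → ℕ
  onCycle W c = 𝟙 (lookup W (v c))

  clique : Subset (N G) → Fin n → ℕ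
  clique W c = sum (λ a → 𝟙 (lookup W (u c a)))

  clique-≤ : ∀ W c → clique W c ≤ p
  clique-≤ W c = begin
    clique W c         ≤⟨ sum-mono-≤ (λ a → 𝟙≤1 (lookup W (u c a))) ⟩
    sum {p} (λ _ → 1)  ≡⟨ sum-const p 1 ⟩
    p * 1              ≡⟨ *-identityʳ p ⟩
    p                  ∎
    where open ≤-Reasoning

  clique-full : ∀ {W} c → (∀ a → u c a ∈ W) → clique W c ≡ p
  clique-full c all = trans (sum-cong-≗ (𝟙-∈ ∘ all)) (trans (sum-const p 1) (*-identityʳ p))

  clique-mono : ∀ {W W′} c → W ⊆ W′ → clique W c ≤ clique W′ c
  clique-mono c W⊆W′ = sum-mono-≤ (λ a → 𝟙-mono {x = u c a} W⊆W′)

  size-by-rows : ∀ S → ∣ S ∣ ≡ sum (λ c → onCycle S c + clique S c)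
  size-by-rows S = trans (size-sum S) (sum-combine n (suc p) (𝟙 ∘ lookup S))

  size-fromRows : ∀ F r → (∀ c → clique (fromRows F) c ≡ r) →
                  ∣ fromRows F ∣ ≡ sum (λ c → 𝟙 (F c zero)) + n * r
  size-fromRows F r cliques = begin
    ∣ fromRows F ∣
      ≡⟨ size-by-rows (fromRows F) ⟩
    sum (λ c → onCycle (fromRows F) c + clique (fromRows F) c)
      ≡⟨ sum-cong-≗ {n} (λ c → cong₂ _+_ (cong 𝟙 (lookup-fromRows F c zero)) (cliques c)) ⟩
    sum {n} (λ c → 𝟙 (F c zero) + r)
      ≡⟨ ∑-distrib-+ {n} (λ c → 𝟙 (F c zero)) (λ _ → r) ⟩
    sum {n} (λ c → 𝟙 (F c zero)) + sum {n} (λ _ → r)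
      ≡⟨ cong (sum {n} (λ c → 𝟙 (F c zero)) +_) (sum-const n r) ⟩
    sum (λ c → 𝟙 (F c zero)) + n * r ∎
    where open ≡-Reasoning

  rowDegreeIn : Fin n → Fin (suc p) → Subset (N G) → Fin n → ℕ
  rowDegreeIn i₀ j₀ W i =
    sum {suc p} (λ j → 𝟙 (coronaAdjPair n (toℕ i₀) (toℕ j₀) (toℕ i) (toℕ j) ∧ lookup W (combine i j)))

  degreeIn-by-rows : ∀ i₀ j₀ W → degreeIn G (combine i₀ j₀) W ≡ sum (rowDegreeIn i₀ j₀ W)
  degreeIn-by-rows i₀ j₀ W = trans (degreeIn-sum G (combine i₀ j₀) W)
    (trans (sum-combine n (suc p) (λ y → 𝟙 (Adj G (combine i₀ j₀) y ∧ lookup W y)))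
           (sum-cong-≗ λ i → sum-cong-≗ λ j →
             cong (λ b → 𝟙 (b ∧ lookup W (combine i j))) (Adj-combine i₀ j₀ i j)))

  -- The test toℕ c ≡ᵇ toℕ i is abstracted as e before splitting on it, since a `with` on it
  -- would also abstract its occurrence inside cycAdj.
  rowDegreeIn-v : ∀ c W i → rowDegreeIn c zero W i ≡
                  𝟙 (cycAdj n (toℕ c) (toℕ i) ∧ lookup W (v i)) + (if toℕ c ≡ᵇ toℕ i then clique W i else 0)
  rowDegreeIn-v c W i = by-test (toℕ c ≡ᵇ toℕ i) (cycAdj n (toℕ c) (toℕ i))
    where
    by-test : ∀ e z →
      sum {suc p} (λ j → 𝟙 (((e ∧ not (0 ≡ᵇ toℕ j)) ∨ ((toℕ j ≡ᵇ 0) ∧ z)) ∧ lookup W (combine i j))) ≡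
      𝟙 (z ∧ lookup W (v i)) + (if e then clique W i else 0)
    by-test true  z = refl
    by-test false z = cong (𝟙 (z ∧ lookup W (v i)) +_) (sum-replicate-zero p)

  rowDegreeIn-u : ∀ c a W i → rowDegreeIn c (suc a) W i ≡
    (if toℕ c ≡ᵇ toℕ i then onCycle W i + sum (λ b → 𝟙 (not (toℕ a ≡ᵇ toℕ b) ∧ lookup W (u i b))) else 0)
  rowDegreeIn-u c a W i with toℕ c ≡ᵇ toℕ i
  ... | true  = cong (onCycle W i +_) (sum-cong-≗ λ b →
                  cong (λ x → 𝟙 (x ∧ lookup W (u i b))) (∨-identityʳ (not (toℕ a ≡ᵇ toℕ b))))
  ... | false = sum-replicate-zero (suc p)

  degreeIn-v : ∀ c W → degreeIn G (v c) W ≡ clique W c + (onCycle W (next c) + onCycle W (prev c))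
  degreeIn-v c W = begin
    degreeIn G (v c) W
      ≡⟨ degreeIn-by-rows c zero W ⟩
    sum (rowDegreeIn c zero W)
      ≡⟨ sum-cong-≗ (rowDegreeIn-v c W) ⟩
    sum (λ i → cycle-nbr i + same-row i)
      ≡⟨ ∑-distrib-+ cycle-nbr same-row ⟩
    sum cycle-nbr + sum same-row
      ≡⟨ cong₂ _+_ (sum-cycAdj c (lookup W ∘ v)) (sum-δ c (clique W)) ⟩
    onCycle W (next c) + onCycle W (prev c) + clique W c
      ≡⟨ +-comm _ (clique W c) ⟩
    clique W c + (onCycle W (next c) + onCycle W (prev c)) ∎
    where
    open ≡-Reasoning
    cycle-nbr same-row : Fin n → ℕ
    cycle-nbr i = 𝟙 (cycAdj n (toℕ c) (toℕ i) ∧ lookup W (v i))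
    same-row  i = if toℕ c ≡ᵇ toℕ i then clique W i else 0

  degreeIn-u : ∀ c a W → degreeIn G (u c a) W + 𝟙 (lookup W (u c a)) ≡ onCycle W c + clique W c
  degreeIn-u c a W = begin
    degreeIn G (u c a) W + 𝟙 (lookup W (u c a))
      ≡⟨ cong (_+ 𝟙 (lookup W (u c a))) (degreeIn-by-rows c (suc a) W) ⟩
    sum (rowDegreeIn c (suc a) W) + 𝟙 (lookup W (u c a))
      ≡⟨ cong (_+ 𝟙 (lookup W (u c a))) (trans (sum-cong-≗ (rowDegreeIn-u c a W)) (sum-δ c same-clique)) ⟩
    onCycle W c + others + 𝟙 (lookup W (u c a))
      ≡⟨ +-assoc (onCycle W c) others _ ⟩
    onCycle W c + (others + 𝟙 (lookup W (u c a)))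
      ≡⟨ cong (onCycle W c +_) (sum-except a (lookup W ∘ u c)) ⟩
    onCycle W c + clique W c ∎
    where
    open ≡-Reasoning
    others : ℕ
    others = sum (λ b → 𝟙 (not (toℕ a ≡ᵇ toℕ b) ∧ lookup W (u c b)))
    same-clique : Fin n → ℕ
    same-clique i = onCycle W i + sum (λ b → 𝟙 (not (toℕ a ≡ᵇ toℕ b) ∧ lookup W (u i b)))

  degreeIn-u-∉ : ∀ c a {W} → u c a ∉ W → degreeIn G (u c a) W ≡ onCycle W c + clique W c
  degreeIn-u-∉ c a {W} ∉W =
    trans (sym (trans (cong (degreeIn G (u c a) W +_) (𝟙-∉ ∉W)) (+-identityʳ _))) (degreeIn-u c a W)

  degree-v : ∀ c → degree G (v c) ≡ p + 2
  degree-v c = begin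
    degree G (v c)                                          ≡⟨ degreeIn-⊤ G (v c) ⟨
    degreeIn G (v c) ⊤                                      ≡⟨ degreeIn-v c ⊤ ⟩
    clique ⊤ c + (onCycle ⊤ (next c) + onCycle ⊤ (prev c))
      ≡⟨ cong₂ _+_ (clique-full {⊤} c (λ _ → ∈⊤)) (cong₂ _+_ (𝟙-⊤ (v (next c))) (𝟙-⊤ (v (prev c)))) ⟩
    p + 2                                                   ∎
    where open ≡-Reasoning

  degree-u : ∀ c a → degree G (u c a) ≡ p
  degree-u c a = +-cancelʳ-≡ _ _ _ (begin
    degree G (u c a) + 1                         ≡⟨ cong₂ _+_ (degreeIn-⊤ G (u c a)) (𝟙-⊤ (u c a)) ⟨
    degreeIn G (u c a) ⊤ + 𝟙 (lookup ⊤ (u c a))  ≡⟨ degreeIn-u c a ⊤ ⟩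
    onCycle ⊤ c + clique ⊤ c                     ≡⟨ cong₂ _+_ (𝟙-⊤ (v c)) (clique-full {⊤} c (λ _ → ∈⊤)) ⟩
    1 + p                                        ≡⟨ +-comm 1 p ⟩
    p + 1                                        ∎)
    where open ≡-Reasoning

  degree-≤ : ∀ x → degree G x ≤ p + 2
  degree-≤ = vertex-cases (≤-reflexive ∘ degree-v)
                          (λ c a → ≤-trans (≤-reflexive (degree-u c a)) (m≤m+n p 2))

  supercritical : ∀ k → p + 3 ≤ k → Inconvertible G k
  supercritical k p+3≤k = Threshold.inconvertible G k λ x →
    <-≤-trans (s≤s (degree-≤ x)) (≤-trans (≤-reflexive (sym (+-suc p 2))) p+3≤k)

  module Critical where
    open Threshold G (p + 2)

    conversion-cliques : ∀ {S} → IsConversionSet G (p + 2) S → ∀ c → clique S c ≡ p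
    conversion-cliques conv c = clique-full c λ a →
      lowDegree-∈ (subst (_< p + 2) (sym (degree-u c a)) (m<m+n p z<s)) conv

    degreeIn-v-< : ∀ {W} c → v (next c) ∉ W ⊎ v (prev c) ∉ W → degreeIn G (v c) W < p + 2
    degreeIn-v-< {W} c missing = begin-strict
      degreeIn G (v c) W
        ≡⟨ degreeIn-v c W ⟩
      clique W c + (onCycle W (next c) + onCycle W (prev c))
        ≤⟨ +-mono-≤ (clique-≤ W c) (one-missing missing) ⟩
      p + 1
        <⟨ +-monoʳ-< p ≤-refl ⟩
      p + 2 ∎
      where
      open ≤-Reasoning
      one-missing : v (next c) ∉ W ⊎ v (prev c) ∉ W → onCycle W (next c) + onCycle W (prev c) ≤ 1
      one-missing (inj₁ ∉W) rewrite 𝟙-∉ ∉W = 𝟙≤1 _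
      one-missing (inj₂ ∉W) rewrite 𝟙-∉ ∉W = ≤-trans (≤-reflexive (+-identityʳ _)) (𝟙≤1 _)

    conversion-covers : ∀ {S} → IsConversionSet G (p + 2) S → ∀ c → v (prev c) ∈ S ⊎ v c ∈ S
    conversion-covers {S} conv c with v (prev c) ∈? S | v c ∈? S
    ... | yes prev∈S | _       = inj₁ prev∈S
    ... | no  _      | yes c∈S = inj₂ c∈S
    ... | no  prev∉S | no  c∉S = ⊥-elim (blocking-¬conversion blocking U∉S (inj₂ refl) conv)
      where
      U : V → Set
      U y = y ≡ v (prev c) ⊎ y ≡ v c
      U∉S : ∀ {y} → U y → y ∉ S
      U∉S (inj₁ refl) = prev∉S
      U∉S (inj₂ refl) = c∉S
      blocking : Blocking U
      blocking (inj₁ refl) W avoid =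
        degreeIn-v-< (prev c) (inj₁ (subst (λ i → v i ∉ W) (sym (next-prev c)) (avoid (inj₂ refl))))
      blocking (inj₂ refl) W avoid = degreeIn-v-< c (inj₂ (avoid (inj₁ refl)))

    conversion-cover-size : ∀ {S} → IsConversionSet G (p + 2) S → ⌈ n /2⌉ ≤ sum (onCycle S)
    conversion-cover-size {S} conv =
      subst (⌈ n /2⌉ ≤_) (sym (n≡⌈n+n/2⌉ (sum (onCycle S)))) (⌈n/2⌉-mono (begin
      n                                          ≡⟨ trans (sym (*-identityʳ n)) (sym (sum-const n 1)) ⟩
      sum {n} (λ _ → 1)                          ≤⟨ sum-mono-≤ covered ⟩
      sum (λ c → onCycle S (prev c) + onCycle S c) ≡⟨ ∑-distrib-+ (onCycle S ∘ prev) (onCycle S) ⟩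
      sum (onCycle S ∘ prev) + sum (onCycle S)   ≡⟨ cong (_+ sum (onCycle S)) (sum-prev (onCycle S)) ⟩
      sum (onCycle S) + sum (onCycle S)          ∎))
      where
      open ≤-Reasoning
      covered : ∀ c → 1 ≤ onCycle S (prev c) + onCycle S c
      covered c with conversion-covers conv c
      ... | inj₁ prev∈S = ≤-trans (≤-reflexive (sym (𝟙-∈ prev∈S))) (m≤m+n _ _)
      ... | inj₂ c∈S    = ≤-trans (≤-reflexive (sym (𝟙-∈ c∈S))) (m≤n+m _ _)

    conversion-size : ∀ {S} → IsConversionSet G (p + 2) S → p * n + ⌈ n /2⌉ ≤ ∣ S ∣
    conversion-size {S} conv = begin
      p * n + ⌈ n /2⌉                       ≤⟨ +-monoʳ-≤ (p * n) (conversion-cover-size conv) ⟩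
      p * n + sum (onCycle S)               ≡⟨ +-comm (p * n) _ ⟩
      sum (onCycle S) + p * n               ≡⟨ cong (sum (onCycle S) +_) cliques ⟩
      sum (onCycle S) + sum (clique S)      ≡⟨ ∑-distrib-+ (onCycle S) (clique S) ⟨
      sum (λ c → onCycle S c + clique S c)  ≡⟨ size-by-rows S ⟨
      ∣ S ∣                                 ∎
      where
      open ≤-Reasoning
      cliques : p * n ≡ sum (clique S)
      cliques = trans (*-comm p n) (trans (sym (sum-const n p)) (sum-cong-≗ (sym ∘ conversion-cliques conv)))

    evenCycle : Fin n → Fin (suc p) → Bool
    evenCycle i zero    = even (toℕ i)
    evenCycle i (suc _) = true

    evenCycle-cliques : ∀ c → clique (fromRows evenCycle) c ≡ p
    evenCycle-cliques c = clique-full c (λ a → ∈-fromRows evenCycle c (suc a) refl)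

    evenCycle-size : ∣ fromRows evenCycle ∣ ≡ p * n + ⌈ n /2⌉
    evenCycle-size = trans (size-fromRows evenCycle p evenCycle-cliques)
                           (trans (cong₂ _+_ (sum-even n) (*-comm n p)) (+-comm ⌈ n /2⌉ (p * n)))

    evenCycle-converts : IsConversionSet G (p + 2) (fromRows evenCycle)
    evenCycle-converts = conversion-at 1 (vertex-cases reach-v reach-u)
      where
      E : Subset (N G)
      E = fromRows evenCycle
      reach-u : ∀ c a → u c a ∈ step G (p + 2) E
      reach-u c a = ⊆-step (∈-fromRows evenCycle c (suc a) refl)
      reach-v : ∀ c → v c ∈ step G (p + 2) E
      reach-v c with even (toℕ c) in parity
      ... | true  = ⊆-step (∈-fromRows evenCycle c zero parity)
      ... | false = ∈-step⁺ (≤-reflexive (sym (begin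
        degreeIn G (v c) E                                      ≡⟨ degreeIn-v c E ⟩
        clique E c + (onCycle E (next c) + onCycle E (prev c))  ≡⟨ cong₂ _+_ (evenCycle-cliques c)
                                                                     (cong₂ _+_ (𝟙-∈ next∈E) (𝟙-∈ prev∈E)) ⟩
        p + 2                                                   ∎)))
        where
        open ≡-Reasoning
        next∈E : v (next c) ∈ E
        next∈E = ∈-fromRows evenCycle (next c) zero (even-next c parity)
        prev∈E : v (prev c) ∈ E
        prev∈E = ∈-fromRows evenCycle (prev c) zero (even-prev c parity)

    convNumber : ConvNumber G (p + 2) (p * n + ⌈ n /2⌉)
    convNumber = (fromRows evenCycle , evenCycle-converts , evenCycle-size) , λ S → conversion-size

  module Subcritical (k′ : ℕ) (k′≤p : k′ ≤ p) where
    open Threshold G (suc k′)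

    conversion-cliques : ∀ {S} → IsConversionSet G (suc k′) S → ∀ c → k′ ≤ clique S c
    conversion-cliques {S} conv c with k′ ≤? clique S c
    ... | yes k′≤ = k′≤
    ... | no  k′≰ = ⊥-elim (blocking-¬conversion blocking U∉S (proj₁ missing , refl , proj₂ missing) conv)
      where
      U : V → Set
      U y = ∃ λ b → y ≡ u c b × y ∉ S
      U∉S : ∀ {y} → U y → y ∉ S
      U∉S (_ , _ , y∉S) = y∉S
      missing : ∃ λ b → u c b ∉ S
      missing = ¬∀⟶∃¬ p (λ b → u c b ∈ S) (λ b → u c b ∈? S) λ all →
        k′≰ (subst (k′ ≤_) (sym (clique-full c all)) k′≤p)
      blocking : Blocking U
      blocking (a , refl , ua∉S) W avoid = begin-strict
        degreeIn G (u c a) W      ≡⟨ degreeIn-u-∉ c a (avoid (a , refl , ua∉S)) ⟩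
        onCycle W c + clique W c  ≤⟨ +-mono-≤ (𝟙≤1 _) (sum-mono-≤ λ b → 𝟙-mono (W∩clique⊆S b)) ⟩
        1 + clique S c            <⟨ s≤s (≰⇒> k′≰) ⟩
        suc k′                    ∎
        where
        open ≤-Reasoning
        W∩clique⊆S : ∀ b → u c b ∈ W → u c b ∈ S
        W∩clique⊆S b ∈W = decidable-stable (u c b ∈? S) (λ ∉S → avoid (b , refl , ∉S) ∈W)

    conversion-heavy-row : ∀ {S} → IsConversionSet G (suc k′) S → ∃ λ c → suc k′ ≤ onCycle S c + clique S c
    conversion-heavy-row {S} conv with any? (λ c → suc k′ ≤? onCycle S c + clique S c)
    ... | yes heavy = heavy
    ... | no  none  = ⊥-elim (blocking-¬conversion blocking (λ y∉S → y∉S) (v∉S zero) conv)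
      where
      light : ∀ c → onCycle S c + clique S c ≤ k′
      light c = s≤s⁻¹ (≰⇒> (λ heavy → none (c , heavy)))
      v∉S : ∀ c → v c ∉ S
      v∉S c v∈S = <-irrefl refl (begin-strict
        clique S c                <⟨ ≤-refl ⟩
        1 + clique S c            ≡⟨ cong (_+ clique S c) (𝟙-∈ v∈S) ⟨
        onCycle S c + clique S c  ≤⟨ light c ⟩
        k′                        ≤⟨ conversion-cliques conv c ⟩
        clique S c                ∎)
        where open ≤-Reasoning
      light-outside : ∀ x → x ∉ S → degreeIn G x S ≤ k′
      light-outside = vertex-cases
        (λ c _ → begin
          degreeIn G (v c) S                                      ≡⟨ degreeIn-v c S ⟩
          clique S c + (onCycle S (next c) + onCycle S (prev c))
            ≡⟨ cong (clique S c +_) (cong₂ _+_ (𝟙-∉ (v∉S (next c))) (𝟙-∉ (v∉S (prev c)))) ⟩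
          clique S c + 0                                          ≡⟨ +-identityʳ _ ⟩
          clique S c                                              ≤⟨ m≤n+m _ _ ⟩
          onCycle S c + clique S c                                ≤⟨ light c ⟩
          k′                                                      ∎)
        (λ c a ua∉S → ≤-trans (≤-reflexive (degreeIn-u-∉ c a ua∉S)) (light c))
        where open ≤-Reasoning
      blocking : Blocking (_∉ S)
      blocking {x} x∉S W avoid = s≤s (≤-trans (degreeIn-mono {x} W⊆S) (light-outside x x∉S))
        where
        W⊆S : W ⊆ S
        W⊆S {y} y∈W = decidable-stable (y ∈? S) (λ y∉S → avoid y∉S y∈W)

    conversion-size : ∀ {S} → IsConversionSet G (suc k′) S → k′ * n + 1 ≤ ∣ S ∣
    conversion-size {S} conv = begin
      k′ * n + 1    ≡⟨ cong (_+ 1) (*-comm k′ n) ⟩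
      n * k′ + 1    ≤⟨ m*a+1≤sum k′ heavy k′≤rowSize heavy-row ⟩
      sum rowSize   ≡⟨ size-by-rows S ⟨
      ∣ S ∣         ∎
      where
      open ≤-Reasoning
      rowSize : Fin n → ℕ
      rowSize c = onCycle S c + clique S c
      k′≤rowSize : ∀ c → k′ ≤ rowSize c
      k′≤rowSize c = ≤-trans (conversion-cliques conv c) (m≤n+m _ (onCycle S c))
      heavy : Fin n
      heavy = proj₁ (conversion-heavy-row conv)
      heavy-row : suc k′ ≤ rowSize heavy
      heavy-row = proj₂ (conversion-heavy-row conv)

    seed : Fin n → Fin (suc p) → Bool
    seed _       (suc a) = toℕ a <ᵇ k′
    seed zero    zero    = true
    seed (suc _) zero    = false

    seed-cliques : ∀ c → clique (fromRows seed) c ≡ k′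
    seed-cliques c = trans (sum-cong-≗ (λ a → cong 𝟙 (lookup-fromRows seed c (suc a)))) (sum-<ᵇ k′ k′≤p)

    seed-size : ∣ fromRows seed ∣ ≡ k′ * n + 1
    seed-size = trans (size-fromRows seed k′ seed-cliques)
      (trans (cong₂ _+_ (cong suc (sum-replicate-zero (2 + m))) (*-comm n k′)) (+-comm 1 (k′ * n)))

    seed-cliques-≥ : ∀ t c → k′ ≤ clique (iter G (suc k′) (fromRows seed) t) c
    seed-cliques-≥ t c = subst (_≤ clique (iter G (suc k′) (fromRows seed) t) c) (seed-cliques c)
                               (clique-mono c (iter-mono (fromRows seed) {t′ = t} z≤n))

    seed-reaches-v : ∀ t c → toℕ c ≡ t → v c ∈ iter G (suc k′) (fromRows seed) t
    seed-reaches-v zero    zero    _    = ∈-fromRows seed zero zero refl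
    seed-reaches-v (suc t) (suc c) c≡t = ∈-step⁺ {Sₜ} (begin
      suc k′
        ≡⟨ +-comm 1 k′ ⟩
      k′ + 1
        ≤⟨ +-mono-≤ (seed-cliques-≥ t (suc c))
                    (≤-trans (≤-reflexive (sym (𝟙-∈ prev-reached))) (m≤n+m _ (onCycle Sₜ (next (suc c))))) ⟩
      clique Sₜ (suc c) + (onCycle Sₜ (next (suc c)) + onCycle Sₜ (prev (suc c)))
        ≡⟨ degreeIn-v (suc c) Sₜ ⟨
      degreeIn G (v (suc c)) Sₜ ∎)
      where
      open ≤-Reasoning
      Sₜ : Subset (N G)
      Sₜ = iter G (suc k′) (fromRows seed) t
      prev-reached : v (prev (suc c)) ∈ Sₜ
      prev-reached = seed-reaches-v t (inject₁ c) (trans (toℕ-inject₁ c) (suc-injective c≡t))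

    seed-reaches-u : ∀ c a → u c a ∈ iter G (suc k′) (fromRows seed) (suc (toℕ c))
    seed-reaches-u c a = reach (u c a ∈? Sₜ)
      where
      open ≤-Reasoning
      Sₜ : Subset (N G)
      Sₜ = iter G (suc k′) (fromRows seed) (toℕ c)
      reach : Dec (u c a ∈ Sₜ) → u c a ∈ step G (suc k′) Sₜ
      reach (yes reached) = ⊆-step reached
      reach (no  ua∉Sₜ)   = ∈-step⁺ {Sₜ} (begin
        suc k′                     ≤⟨ s≤s (seed-cliques-≥ (toℕ c) c) ⟩
        1 + clique Sₜ c            ≡⟨ cong (_+ clique Sₜ c) (𝟙-∈ (seed-reaches-v (toℕ c) c refl)) ⟨
        onCycle Sₜ c + clique Sₜ c ≡⟨ degreeIn-u-∉ c a ua∉Sₜ ⟨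
        degreeIn G (u c a) Sₜ      ∎)

    seed-converts : IsConversionSet G (suc k′) (fromRows seed)
    seed-converts = conversion-at n (vertex-cases
      (λ c → iter-mono (fromRows seed) (<⇒≤ (toℕ<n c)) (seed-reaches-v (toℕ c) c refl))
      (λ c a → iter-mono (fromRows seed) (toℕ<n c) (seed-reaches-u c a)))

    convNumber : ConvNumber G (suc k′) (k′ * n + 1)
    convNumber = (fromRows seed , seed-converts , seed-size) , λ S → conversion-size

  subcritical : ∀ k → 1 ≤ k → k ≤ p + 1 → ConvNumber G k ((k ∸ 1) * n + 1)
  subcritical (suc k′) _ k≤p+1 = Subcritical.convNumber k′ (s≤s⁻¹ (subst (suc k′ ≤_) (+-comm p 1) k≤p+1))

  critical : ConvNumber G (p + 2) (p * n + ⌈ n /2⌉)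
  critical = Critical.convNumber

mainTheorem2 : (n p k : ℕ) → 3 ≤ n → 1 ≤ p → 1 ≤ k →
    (k ≤ p + 1 → ConvNumber (CnCoronaKp n p) k ((k ∸ 1) * n + 1))
    × (k ≡ p + 2 → ConvNumber (CnCoronaKp n p) k (p * n + ⌈ n /2⌉))
    × (p + 3 ≤ k → Inconvertible (CnCoronaKp n p) k)
mainTheorem2 (suc (suc (suc m))) p k (s≤s (s≤s (s≤s _))) _ 1≤k =
  subcritical k 1≤k , (λ { refl → critical }) , supercritical k
  where open Corona m p
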